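{- Let $D$ be the set of Dyck numbers and for $n\ge1$ let $E_n=\{t\in D:\ 2^{n-1}\le t\le 2^n-1\}$. For every even $n\ge 6$, $$\#E_n=4\cdot\#E_{n-2}-\mathrm{Cat}(n/2-1)=2\cdot\#E_{n-1}-\mathrm{Cat}(n/2-1),$$ where $\mathrm{Cat}(m)=\frac{1}{m+1}\binom{2m}{m}$ is the $m$-th Catalan number.
   Context: A Dyck number is a nonnegative integer $t$ such that every suffix of the binary representation of $t$ (i.e. every block of least significant bits) contains at least as many 1's as 0's; these form OEIS A036991: $0,1,3,5,7,11,13,15,19,21,\dots$. -}

module Defs where

open import Data.Nat using (ℕ; zero; suc; _+_; _*_; _∸_; _^_; _/_; _%_; _≤_; _≡ᵇ_)
open import Data.Nat.Properties using (_≤?_)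
open import Data.Nat.Combinatorics using (_C_)
open import Data.Nat.Induction using (<-wellFounded)
open import Data.Bool using (Bool; true; false)
open import Data.List using (List; []; _∷_; length; filter; inits; upTo; map; applyUpTo)
open import Data.List.Relation.Unary.All using (All; all?)
open import Relation.Nullary using (Dec)

-- binary representation of t, least significant bit first (0 has the empty representation)
-- fuel-based: t has at most t bits
bitsAux : ℕ → ℕ → List Bool
bitsAux zero    t = []
bitsAux (suc f) zero = []
bitsAux (suc f) t@(suc _) = (t % 2 ≡ᵇ 1) ∷ bitsAux f (t / 2)

bits : ℕ → List Bool
bits t = bitsAux t t

ones zeros : List Bool → ℕ
ones [] = 0
ones (true ∷ bs) = suc (ones bs)
ones (false ∷ bs) = ones bs
zeros [] = 0
zeros (true ∷ bs) = zeros bs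
zeros (false ∷ bs) = suc (zeros bs)

IsDyck : ℕ → Set
IsDyck t = All (λ s → zeros s ≤ ones s) (inits (bits t))

isDyck? : (t : ℕ) → Dec (IsDyck t)
isDyck? t = all? (λ s → zeros s ≤? ones s) (inits (bits t))

E : ℕ → List ℕ
E n = filter isDyck? (applyUpTo (λ i → 2 ^ (n ∸ 1) + i) (2 ^ (n ∸ 1)))

#E : ℕ → ℕ
#E n = length (E n)

Cat : ℕ → ℕ
Cat m = ((2 * m) C m) / suc m

-- Reading the binary digits of t from the least significant one as up (1) and down (0)
-- steps, the Dyck numbers with n digits are exactly the numbers whose first n − 1 digits
-- form a lattice walk that never goes below height 0 (the leading 1 is an up step).
-- So #E_{m+1} = W_m, the number of such walks of length m. Every walk extends in two ways,
-- except that a walk ending at height 0 cannot step down; hence W_{m+1} = 2 W_m − Z_m,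
-- where Z_m counts the walks returning to 0. Z_m vanishes for odd m, and by the reflection
-- principle Z_{2j} = C(2j, j) − C(2j, j − 1) = Cat(j). Two steps of the recurrence give
-- both identities.
module Submission where

open import Defs
open import Data.Nat using (ℕ; _+_; _*_; _∸_; _/_; _≤_)
open import Data.Product using (_×_)
open import Relation.Binary.PropositionalEquality using (_≡_)

open import Data.Bool using (Bool; true; false; if_then_else_)
open import Data.List using (List; _∷_; length; filter; inits; applyUpTo)
open import Data.List.Relation.Unary.All as All using (All; _∷_; all?)
open import Data.List.Relation.Unary.All.Properties using (map⁺; map⁻)
open import Data.Nat using (zero; suc; pred; _^_; _%_; _≡ᵇ_; _<_; z≤n; s≤s; s≤s⁻¹; parity)
open import Data.Nat.Combinatorics using (_C_; nCk+nC[k+1]≡[n+1]C[k+1]; nCk≡nC[n∸k]; nC1≡n)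
open import Data.Nat.DivMod using (m/n<m; m*n%n≡0; m*n/n≡m; [m+kn]%n≡m%n; +-distrib-/-∣ʳ)
open import Data.Nat.Divisibility using (m∣m*n)
open import Data.Nat.Properties
open import Algebra.Properties.CommutativeSemigroup +-commutativeSemigroup using (interchange)
open import Data.Parity.Base as ℙ using (1ℙ)
open import Data.Parity.Properties using (suc-homo-⁻¹; +-homo-+; *-homo-*; ⁻¹-injective)
open import Data.Nat.Tactic.RingSolver using (solve-∀)
open import Data.Product using (_,_)
open import Function using (_∘_; case_of_)
open import Function.Bundles using (_⇔_; mk⇔)
open import Relation.Nullary using (Dec; ¬_; does; contradiction)
open import Relation.Nullary.Decidable using (does-⇔; dec-false)
open import Relation.Unary using (Pred; Decidable)
open import Relation.Binary.PropositionalEquality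
  using (_≢_; _≗_; refl; sym; trans; cong; cong₂; subst; module ≡-Reasoning)

open ≡-Reasoning

[1+t]/2≤t : ∀ t → suc t / 2 ≤ t
[1+t]/2≤t t = s≤s⁻¹ (m/n<m (suc t) 2 (s≤s (s≤s z≤n)))

bitsAux-fuel : ∀ {f g} t → t ≤ f → t ≤ g → bitsAux f t ≡ bitsAux g t
bitsAux-fuel {zero}  {zero}  zero _ _ = refl
bitsAux-fuel {zero}  {suc _} zero _ _ = refl
bitsAux-fuel {suc _} {zero}  zero _ _ = refl
bitsAux-fuel {suc _} {suc _} zero _ _ = refl
bitsAux-fuel {suc _} {suc _} (suc t) (s≤s t≤f) (s≤s t≤g) =
  cong ((suc t % 2 ≡ᵇ 1) ∷_) (bitsAux-fuel (suc t / 2) (≤-trans ([1+t]/2≤t t) t≤f) (≤-trans ([1+t]/2≤t t) t≤g))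

bits-suc : ∀ t → bits (suc t) ≡ (suc t % 2 ≡ᵇ 1) ∷ bits (suc t / 2)
bits-suc t = cong ((suc t % 2 ≡ᵇ 1) ∷_) (bitsAux-fuel (suc t / 2) ([1+t]/2≤t t) ≤-refl)

bits-double : ∀ {x} → 0 < x → bits (2 * x) ≡ false ∷ bits x
bits-double {x@(suc _)} _ = trans (bits-suc (pred (2 * x))) (cong₂ (λ r q → (r ≡ᵇ 1) ∷ bits q) [2x]%2≡0 [2x]/2≡x)
  where
  [2x]%2≡0 : 2 * x % 2 ≡ 0
  [2x]%2≡0 = trans (cong (_% 2) (*-comm 2 x)) (m*n%n≡0 x 2)
  [2x]/2≡x : 2 * x / 2 ≡ x
  [2x]/2≡x = trans (cong (_/ 2) (*-comm 2 x)) (m*n/n≡m x 2)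

bits-double+1 : ∀ x → bits (1 + 2 * x) ≡ true ∷ bits x
bits-double+1 x = trans (bits-suc (2 * x)) (cong₂ (λ r q → (r ≡ᵇ 1) ∷ bits q) [1+2x]%2≡1 [1+2x]/2≡x)
  where
  [1+2x]%2≡1 : (1 + 2 * x) % 2 ≡ 1
  [1+2x]%2≡1 = trans (cong (λ y → (1 + y) % 2) (*-comm 2 x)) ([m+kn]%n≡m%n 1 x 2)
  [1+2x]/2≡x : (1 + 2 * x) / 2 ≡ x
  [1+2x]/2≡x = trans (+-distrib-/-∣ʳ 1 {d = 2} (m∣m*n x)) (trans (cong (_/ 2) (*-comm 2 x)) (m*n/n≡m x 2))

DyckFrom : ℕ → List Bool → Set
DyckFrom h bs = All (λ s → zeros s ≤ h + ones s) (inits bs)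

dyckFrom? : ∀ h bs → Dec (DyckFrom h bs)
dyckFrom? h bs = all? (λ s → zeros s ≤? h + ones s) (inits bs)

dyckFrom-up : ∀ {h} bs → DyckFrom h (true ∷ bs) ⇔ DyckFrom (suc h) bs
dyckFrom-up {h} bs = mk⇔
  (λ { (_ ∷ ps) → All.map (λ {s} → subst (zeros s ≤_) (+-suc h (ones s))) (map⁻ ps) })
  (λ ps → z≤n ∷ map⁺ (All.map (λ {s} → subst (zeros s ≤_) (sym (+-suc h (ones s)))) ps))

dyckFrom-down : ∀ {h} bs → DyckFrom (suc h) (false ∷ bs) ⇔ DyckFrom h bs
dyckFrom-down bs = mk⇔
  (λ { (_ ∷ ps) → All.map s≤s⁻¹ (map⁻ ps) })
  (λ ps → z≤n ∷ map⁺ (All.map s≤s ps))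

¬dyckFrom-0-down : ∀ bs → ¬ DyckFrom 0 (false ∷ bs)
¬dyckFrom-0-down bs (_ ∷ () ∷ _)

dyckFromᵇ : ℕ → List Bool → Bool
dyckFromᵇ h bs = does (dyckFrom? h bs)

dyckFromᵇ-up : ∀ h bs → dyckFromᵇ h (true ∷ bs) ≡ dyckFromᵇ (suc h) bs
dyckFromᵇ-up h bs = does-⇔ (dyckFrom-up bs) (dyckFrom? h (true ∷ bs)) (dyckFrom? (suc h) bs)

dyckFromᵇ-down : ∀ h bs → dyckFromᵇ (suc h) (false ∷ bs) ≡ dyckFromᵇ h bs
dyckFromᵇ-down h bs = does-⇔ (dyckFrom-down bs) (dyckFrom? (suc h) (false ∷ bs)) (dyckFrom? h bs)

dyckFromᵇ-0-down : ∀ bs → dyckFromᵇ 0 (false ∷ bs) ≡ false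
dyckFromᵇ-0-down bs = dec-false (dyckFrom? 0 (false ∷ bs)) (¬dyckFrom-0-down bs)

count : (ℕ → Bool) → ℕ → ℕ
count p zero    = 0
count p (suc n) = (if p 0 then 1 else 0) + count (p ∘ suc) n

length-filter-applyUpTo : ∀ {a ℓ} {A : Set a} {P : Pred A ℓ} (P? : Decidable P) (f : ℕ → A) n →
  length (filter P? (applyUpTo f n)) ≡ count (λ i → does (P? (f i))) n
length-filter-applyUpTo P? f zero = refl
length-filter-applyUpTo P? f (suc n) with does (P? (f 0))
... | true  = cong suc (length-filter-applyUpTo P? (f ∘ suc) n)
... | false = length-filter-applyUpTo P? (f ∘ suc) n

count-cong : ∀ {p q} n → p ≗ q → count p n ≡ count q n
count-cong zero    p≗q = refl
count-cong (suc n) p≗q = cong₂ (λ b c → (if b then 1 else 0) + c) (p≗q 0) (count-cong n (p≗q ∘ suc))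

count-false : ∀ n → count (λ _ → false) n ≡ 0
count-false zero    = refl
count-false (suc n) = count-false n

count-double : ∀ p n → count p (2 * n) ≡ count (λ j → p (2 * j)) n + count (λ j → p (1 + 2 * j)) n
count-double p zero    = refl
count-double p (suc n) = begin
  count p (2 * suc n)                                ≡⟨ cong (count p) (*-suc 2 n) ⟩
  [p0] + ([p1] + count (p ∘ suc ∘ suc) (2 * n))      ≡⟨ cong (λ c → [p0] + ([p1] + c)) (count-double (p ∘ suc ∘ suc) n) ⟩
  [p0] + ([p1] + (evens + odds))                     ≡⟨ sym (+-assoc [p0] [p1] _) ⟩
  ([p0] + [p1]) + (evens + odds)                     ≡⟨ interchange [p0] [p1] evens odds ⟩
  ([p0] + evens) + ([p1] + odds)                     ≡⟨ cong₂ (λ e o → ([p0] + e) + ([p1] + o))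
                                                          (count-cong n (λ j → cong p (sym (*-suc 2 j))))
                                                          (count-cong n (λ j → cong (p ∘ suc) (sym (*-suc 2 j)))) ⟩
  count (λ j → p (2 * j)) (suc n) + count (λ j → p (1 + 2 * j)) (suc n) ∎
  where
  [p0] = if p 0 then 1 else 0
  [p1] = if p 1 then 1 else 0
  evens = count (λ j → p (2 + 2 * j)) n
  odds  = count (λ j → p (3 + 2 * j)) n

#DyckFrom : ℕ → ℕ → ℕ
#DyckFrom m h = count (λ i → dyckFromᵇ h (bits (2 ^ m + i))) (2 ^ m)

-- Definitionally, isDyck? t is dyckFrom? 0 (bits t).
#E≡#DyckFrom : ∀ m → #E (suc m) ≡ #DyckFrom m 0
#E≡#DyckFrom m = length-filter-applyUpTo isDyck? (2 ^ m +_) (2 ^ m)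

#DyckFrom-split : ∀ m h → #DyckFrom (suc m) h ≡
  count (λ j → dyckFromᵇ h (false ∷ bits (2 ^ m + j))) (2 ^ m) +
  count (λ j → dyckFromᵇ h (true ∷ bits (2 ^ m + j))) (2 ^ m)
#DyckFrom-split m h = trans (count-double _ (2 ^ m)) (cong₂ _+_ (count-cong (2 ^ m) even) (count-cong (2 ^ m) odd))
  where
  [2^m+j]*2≡ : ∀ j → 2 ^ suc m + 2 * j ≡ 2 * (2 ^ m + j)
  [2^m+j]*2≡ j = sym (*-distribˡ-+ 2 (2 ^ m) j)
  even : ∀ j → dyckFromᵇ h (bits (2 ^ suc m + 2 * j)) ≡ dyckFromᵇ h (false ∷ bits (2 ^ m + j))
  even j = cong (dyckFromᵇ h)
    (trans (cong bits ([2^m+j]*2≡ j)) (bits-double (<-≤-trans (m^n>0 2 m) (m≤m+n (2 ^ m) j))))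
  odd : ∀ j → dyckFromᵇ h (bits (2 ^ suc m + (1 + 2 * j))) ≡ dyckFromᵇ h (true ∷ bits (2 ^ m + j))
  odd j = cong (dyckFromᵇ h)
    (trans (cong bits (trans (+-suc (2 ^ suc m) (2 * j)) (cong suc ([2^m+j]*2≡ j)))) (bits-double+1 (2 ^ m + j)))

#DyckFrom-suc-zero : ∀ m → #DyckFrom (suc m) 0 ≡ #DyckFrom m 1
#DyckFrom-suc-zero m = trans (#DyckFrom-split m 0) (cong₂ _+_
  (trans (count-cong (2 ^ m) (λ j → dyckFromᵇ-0-down (bits (2 ^ m + j)))) (count-false (2 ^ m)))
  (count-cong (2 ^ m) (λ j → dyckFromᵇ-up 0 (bits (2 ^ m + j)))))

#DyckFrom-suc-suc : ∀ m h → #DyckFrom (suc m) (suc h) ≡ #DyckFrom m h + #DyckFrom m (suc (suc h))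
#DyckFrom-suc-suc m h = trans (#DyckFrom-split m (suc h)) (cong₂ _+_
  (count-cong (2 ^ m) (λ j → dyckFromᵇ-down h (bits (2 ^ m + j))))
  (count-cong (2 ^ m) (λ j → dyckFromᵇ-up (suc h) (bits (2 ^ m + j)))))

-- walks m h counts the walks of m steps ±1 from height h that never go below 0;
-- walksTo0 m h counts those among them that end at height 0.
walks : ℕ → ℕ → ℕ
walks zero    h       = 1
walks (suc m) zero    = walks m 1
walks (suc m) (suc h) = walks m h + walks m (suc (suc h))

walksTo0 : ℕ → ℕ → ℕ
walksTo0 zero    zero    = 1
walksTo0 zero    (suc h) = 0
walksTo0 (suc m) zero    = walksTo0 m 1
walksTo0 (suc m) (suc h) = walksTo0 m h + walksTo0 m (suc (suc h))

#DyckFrom≡walks : ∀ m h → #DyckFrom m h ≡ walks m h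
#DyckFrom≡walks zero    h       = refl
#DyckFrom≡walks (suc m) zero    = trans (#DyckFrom-suc-zero m) (#DyckFrom≡walks m 1)
#DyckFrom≡walks (suc m) (suc h) =
  trans (#DyckFrom-suc-suc m h) (cong₂ _+_ (#DyckFrom≡walks m h) (#DyckFrom≡walks m (suc (suc h))))

#E≡walks : ∀ m → #E (suc m) ≡ walks m 0
#E≡walks m = trans (#E≡#DyckFrom m) (#DyckFrom≡walks m 0)

walks-suc : ∀ m h → walks (suc m) h + walksTo0 m h ≡ 2 * walks m h
walks-suc zero    zero    = refl
walks-suc zero    (suc h) = refl
walks-suc (suc m) zero    = walks-suc m 1
walks-suc (suc m) (suc h) = begin
  (walks (suc m) h + walks (suc m) (2 + h)) + (walksTo0 m h + walksTo0 m (2 + h))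
    ≡⟨ interchange (walks (suc m) h) _ _ _ ⟩
  (walks (suc m) h + walksTo0 m h) + (walks (suc m) (2 + h) + walksTo0 m (2 + h))
    ≡⟨ cong₂ _+_ (walks-suc m h) (walks-suc m (2 + h)) ⟩
  2 * walks m h + 2 * walks m (2 + h)
    ≡⟨ sym (*-distribˡ-+ 2 (walks m h) _) ⟩
  2 * (walks m h + walks m (2 + h)) ∎

#E-recurrence : ∀ m → #E (2 + m) + walksTo0 m 0 ≡ 2 * #E (1 + m)
#E-recurrence m = begin
  #E (2 + m) + walksTo0 m 0    ≡⟨ cong (_+ walksTo0 m 0) (#E≡walks (suc m)) ⟩
  walks (suc m) 0 + walksTo0 m 0 ≡⟨ walks-suc m 0 ⟩
  2 * walks m 0                ≡⟨ cong (2 *_) (#E≡walks m) ⟨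
  2 * #E (1 + m)               ∎

parity-suc-cong : ∀ {m n} → parity m ≡ parity n → parity (suc m) ≡ parity (suc n)
parity-suc-cong {m} {n} eq = ⁻¹-injective (trans (suc-homo-⁻¹ m) (trans eq (sym (suc-homo-⁻¹ n))))

walksTo0-parity : ∀ {m h} → parity m ≢ parity h → walksTo0 m h ≡ 0
walksTo0-parity {zero}  {zero}  m≢h = contradiction refl m≢h
walksTo0-parity {zero}  {suc h} _   = refl
walksTo0-parity {suc m} {zero}  m≢h = walksTo0-parity {m} {1} (m≢h ∘ parity-suc-cong {m} {1})
walksTo0-parity {suc m} {suc h} m≢h =
  cong₂ _+_ (walksTo0-parity {m} {h} (m≢h ∘ parity-suc-cong {m} {h}))
            (walksTo0-parity {m} {suc (suc h)} (m≢h ∘ parity-suc-cong {m} {suc (suc h)}))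

walksTo0-odd : ∀ i → walksTo0 (1 + 2 * i) 0 ≡ 0
walksTo0-odd i = walksTo0-parity {1 + 2 * i} {0} λ eq → case trans (sym odd) eq of λ ()
  where
  odd : parity (1 + 2 * i) ≡ 1ℙ
  odd = trans (+-homo-+ 1 (2 * i)) (cong (1ℙ ℙ.+_) (*-homo-* 2 i))

walksTo0-< : ∀ {m h} → m < h → walksTo0 m h ≡ 0
walksTo0-< {zero}  {suc h} _         = refl
walksTo0-< {suc m} {suc h} (s≤s m<h) =
  cong₂ _+_ (walksTo0-< m<h) (walksTo0-< (m<n⇒m<1+n (m<n⇒m<1+n m<h)))

walksTo0-diag : ∀ h → walksTo0 h h ≡ 1
walksTo0-diag zero    = refl
walksTo0-diag (suc h) = cong₂ _+_ (walksTo0-diag h) (walksTo0-< (m<n⇒m<1+n (n<1+n h)))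

C-sym : ∀ {n} k l → k + l ≡ n → n C k ≡ n C l
C-sym k l refl = trans (nCk≡nC[n∸k] (m≤m+n k l)) (cong ((k + l) C_) (m+n∸m≡n k l))

-- n C⁻ k is C(n, k − 1), with C(n, −1) = 0 (whereas n C (0 ∸ 1) = 1).
infixl 6.5 _C⁻_

_C⁻_ : ℕ → ℕ → ℕ
n C⁻ zero  = 0
n C⁻ suc k = n C k

nC⁻k+nCk≡[1+n]Ck : ∀ n k → n C⁻ k + n C k ≡ suc n C k
nC⁻k+nCk≡[1+n]Ck n zero    = refl
nC⁻k+nCk≡[1+n]Ck n (suc k) = nCk+nC[k+1]≡[n+1]C[k+1] n k

-- The reflection principle walksTo0 (h + 2u) h = C(h + 2u, u) − C(h + 2u, u − 1), subtraction-free.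
ballot : ∀ u h → walksTo0 (h + 2 * u) h + (h + 2 * u) C⁻ u ≡ (h + 2 * u) C u
ballot zero h = trans (+-identityʳ _) (trans (cong (λ n → walksTo0 n h) (+-identityʳ h)) (walksTo0-diag h))
ballot (suc v) zero = subst (λ n → walksTo0 n 0 + n C⁻ suc v ≡ n C suc v) (sym (*-suc 2 v)) (begin
  walksTo0 n 1 + suc n C v          ≡⟨ cong (walksTo0 n 1 +_) (nC⁻k+nCk≡[1+n]Ck n v) ⟨
  walksTo0 n 1 + (n C⁻ v + n C v)   ≡⟨ +-assoc (walksTo0 n 1) _ _ ⟨
  (walksTo0 n 1 + n C⁻ v) + n C v   ≡⟨ cong (_+ n C v) (ballot v 1) ⟩
  n C v + n C v                     ≡⟨ cong (n C v +_) (C-sym v (suc v) (v+[1+v]≡1+2v v)) ⟩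
  n C v + n C suc v                 ≡⟨ nCk+nC[k+1]≡[n+1]C[k+1] n v ⟩
  suc n C suc v                     ∎)
  where
  n = 1 + 2 * v
  v+[1+v]≡1+2v : ∀ v → v + suc v ≡ 1 + 2 * v
  v+[1+v]≡1+2v = solve-∀
ballot (suc v) (suc h) = begin
  (a + b) + suc M C v  ≡⟨ cong ((a + b) +_) (nC⁻k+nCk≡[1+n]Ck M v) ⟨
  (a + b) + (c + d)    ≡⟨ cong ((a + b) +_) (+-comm c d) ⟩
  (a + b) + (d + c)    ≡⟨ interchange a b d c ⟩
  (a + d) + (b + c)    ≡⟨ cong₂ _+_ (ballot (suc v) h) b+c≡d ⟩
  M C suc v + M C v    ≡⟨ +-comm (M C suc v) (M C v) ⟩
  M C v + M C suc v    ≡⟨ nCk+nC[k+1]≡[n+1]C[k+1] M v ⟩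
  suc M C suc v        ∎
  where
  M = h + 2 * suc v
  a = walksTo0 M h
  b = walksTo0 M (2 + h)
  c = M C⁻ v
  d = M C v
  2+h+2v≡h+2[1+v] : ∀ h v → 2 + h + 2 * v ≡ h + 2 * suc v
  2+h+2v≡h+2[1+v] = solve-∀
  b+c≡d : b + c ≡ d
  b+c≡d = subst (λ n → walksTo0 n (2 + h) + n C⁻ v ≡ n C v) (2+h+2v≡h+2[1+v] h v) (ballot v (2 + h))

absorption : ∀ n k → suc k * (suc n C suc k) ≡ suc n * (n C k)
absorption n       zero    = trans (+-identityʳ _) (trans (nC1≡n (suc n)) (sym (*-identityʳ (suc n))))
absorption zero    (suc k) = *-zeroʳ (suc (suc k))
absorption (suc n) (suc k) = begin
  suc (suc k) * (suc (suc n) C suc (suc k))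
    ≡⟨ cong (suc (suc k) *_) (nCk+nC[k+1]≡[n+1]C[k+1] (suc n) (suc k)) ⟨
  suc (suc k) * (A + B)
    ≡⟨ *-distribˡ-+ (suc (suc k)) A B ⟩
  (A + suc k * A) + suc (suc k) * B
    ≡⟨ cong₂ (λ x y → (A + x) + y) (absorption n k) (absorption n (suc k)) ⟩
  (A + suc n * (n C k)) + suc n * (n C suc k)
    ≡⟨ +-assoc A _ _ ⟩
  A + (suc n * (n C k) + suc n * (n C suc k))
    ≡⟨ cong (A +_) (*-distribˡ-+ (suc n) (n C k) _) ⟨
  A + suc n * (n C k + n C suc k)
    ≡⟨ cong (λ x → A + suc n * x) (nCk+nC[k+1]≡[n+1]C[k+1] n k) ⟩
  A + suc n * A ∎
  where
  A = suc n C suc k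
  B = suc n C suc (suc k)

[1+j]*[2j]C⁻j≡j*[2j]Cj : ∀ j → suc j * (2 * j C⁻ j) ≡ j * (2 * j C j)
[1+j]*[2j]C⁻j≡j*[2j]Cj zero    = refl
[1+j]*[2j]C⁻j≡j*[2j]Cj (suc i) = begin
  suc (suc i) * (n C i)            ≡⟨ cong (suc (suc i) *_) (C-sym i (2 + i) (i+[2+i]≡n i)) ⟩
  suc (suc i) * (n C suc (suc i))  ≡⟨ absorption (pred n) (suc i) ⟩
  n * (pred n C suc i)             ≡⟨ cong (n *_) (C-sym {pred n} i (suc i) (cong pred (1+[i+[1+i]]≡n i))) ⟨
  n * (pred n C i)                 ≡⟨ absorption (pred n) i ⟨
  suc i * (n C suc i)              ∎
  where
  n = 2 * suc i
  i+[2+i]≡n : ∀ i → i + (2 + i) ≡ 2 * suc i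
  i+[2+i]≡n = solve-∀
  1+[i+[1+i]]≡n : ∀ i → 1 + (i + suc i) ≡ 2 * suc i
  1+[i+[1+i]]≡n = solve-∀

Cat≡walksTo0 : ∀ j → Cat j ≡ walksTo0 (2 * j) 0
Cat≡walksTo0 j = begin
  X / suc j        ≡⟨ cong (_/ suc j) X≡z*[1+j] ⟩
  z * suc j / suc j ≡⟨ m*n/n≡m z (suc j) ⟩
  z                ∎
  where
  X = 2 * j C j
  z = walksTo0 (2 * j) 0
  X≡z*[1+j] : X ≡ z * suc j
  X≡z*[1+j] = +-cancelʳ-≡ (j * X) X (z * suc j) (begin
    suc j * X                         ≡⟨ cong (suc j *_) (ballot j 0) ⟨
    suc j * (z + 2 * j C⁻ j)          ≡⟨ *-distribˡ-+ (suc j) z _ ⟩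
    suc j * z + suc j * (2 * j C⁻ j)  ≡⟨ cong₂ _+_ (*-comm (suc j) z) ([1+j]*[2j]C⁻j≡j*[2j]Cj j) ⟩
    z * suc j + j * X                 ∎)

#E-recurrence-even : ∀ j → #E (2 + 2 * j) + Cat j ≡ 2 * #E (1 + 2 * j)
#E-recurrence-even j = trans (cong (#E (2 + 2 * j) +_) (Cat≡walksTo0 j)) (#E-recurrence (2 * j))

#E-recurrence-odd : ∀ i → #E (1 + 2 * suc i) ≡ 2 * #E (2 * suc i)
#E-recurrence-odd i = subst (λ n → #E (1 + n) ≡ 2 * #E n) (sym (*-suc 2 i)) (begin
  #E (3 + 2 * i)                            ≡⟨ +-identityʳ _ ⟨
  #E (3 + 2 * i) + 0                        ≡⟨ cong (#E (3 + 2 * i) +_) (walksTo0-odd i) ⟨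
  #E (3 + 2 * i) + walksTo0 (1 + 2 * i) 0   ≡⟨ #E-recurrence (1 + 2 * i) ⟩
  2 * #E (2 + 2 * i)                        ∎)

proposition10 : (k : ℕ) → 6 ≤ 2 * k →
    (#E (2 * k) + Cat (k ∸ 1) ≡ 4 * #E (2 * k ∸ 2))
    × (#E (2 * k) + Cat (k ∸ 1) ≡ 2 * #E (2 * k ∸ 1))
proposition10 zero          ()
proposition10 (suc zero)    (s≤s (s≤s ()))
proposition10 (suc (suc i)) _ =
  subst (λ n → (#E n + Cat j ≡ 4 * #E (n ∸ 2)) × (#E n + Cat j ≡ 2 * #E (n ∸ 1)))
        (sym (*-suc 2 j)) (fourfold , #E-recurrence-even j)
  where
  j = suc i
  fourfold : #E (2 + 2 * j) + Cat j ≡ 4 * #E (2 * j)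
  fourfold = begin
    #E (2 + 2 * j) + Cat j  ≡⟨ #E-recurrence-even j ⟩
    2 * #E (1 + 2 * j)      ≡⟨ cong (2 *_) (#E-recurrence-odd i) ⟩
    2 * (2 * #E (2 * j))    ≡⟨ *-assoc 2 2 (#E (2 * j)) ⟨
    4 * #E (2 * j)          ∎
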